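{- Let $p$ and $q_5$ be distinct odd prime numbers. Then the equation $4q_5^2-3p^x=\pm1$ has no positive integer solution $x$ (for either sign). -}

module Defs where

{-# OPTIONS --safe #-}
-- Reducing mod 3, 4q² + 1 ≡ q² + 1 is never 0, as −1 is not a square mod 3.
-- For the other sign, 4q² − 1 = (2q − 1)(2q + 1) = 3pˣ. The prime 3 divides one
-- factor; since q ≥ 3 its cofactor and the other factor are divisors of pˣ
-- greater than 1, hence multiples of p. So p divides both 2q − 1 and 2q + 1,
-- hence their difference 2, forcing p = 2.
module Submission where

open import Defs
open import Data.Nat using (ℕ; _+_; _*_; _^_)
open import Data.Nat.Primality using (Prime)
open import Data.Nat.Base using (NonZero)
open import Data.Product using (_×_)
open import Data.Sum using (_⊎_)
open import Relation.Nullary using (¬_)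
open import Relation.Binary.PropositionalEquality using (_≡_; _≢_)

open import Data.Nat.Base using (zero; suc; _<_; s≤s; z≤n)
open import Data.Nat.Properties using (*-comm; *-cancelˡ-≡; *-cancelʳ-<; <-trans; >⇒≢; +-comm; suc-injective)
open import Data.Nat.Divisibility
open import Data.Nat.Coprimality using (Coprime; coprime-divisor)
open import Data.Nat.Primality using (prime⇒irreducible; ¬prime[0]; ¬prime[1]; prime[2]; prime?; euclidsLemma)
open import Data.Nat.Tactic.RingSolver using (solve)
open import Data.List.Base using ([]; _∷_)
open import Data.Product using (_,_; swap)
open import Data.Sum using (inj₁; inj₂)
open import Relation.Nullary using (yes; no; contradiction)
open import Relation.Nullary.Decidable using (from-yes; from-no)
open import Relation.Binary.PropositionalEquality using (refl; sym; trans; subst; module ≡-Reasoning)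

private
  variable
    a b d m p x : ℕ

1<3 : 1 < 3
1<3 = s≤s (s≤s z≤n)

prime[3] : Prime 3
prime[3] = from-yes (prime? 3)

prime∤⇒coprime : Prime p → p ∤ m → Coprime m p
prime∤⇒coprime p-prime p∤m (d∣m , d∣p) with prime⇒irreducible p-prime d∣p
... | inj₁ d≡1  = d≡1
... | inj₂ refl = contradiction d∣m p∤m

∣p^x⇒p∣ : Prime p → 1 < d → d ∣ p ^ x → p ∣ d
∣p^x⇒p∣ {x = zero}      _       1<d d∣1       = contradiction (∣1⇒≡1 d∣1) (>⇒≢ 1<d)
∣p^x⇒p∣ {p} {d} {suc x} p-prime 1<d d∣p^[1+x] with p ∣? d
... | yes p∣d = p∣d
... | no  p∤d = ∣p^x⇒p∣ {x = x} p-prime 1<d (coprime-divisor (prime∤⇒coprime p-prime p∤d) d∣p^[1+x])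

∣n+m∣m⇒∣n : ∀ n → d ∣ n + m → d ∣ m → d ∣ n
∣n+m∣m⇒∣n {d} {m} n d∣n+m = ∣m+n∣m⇒∣n (subst (d ∣_) (+-comm n m) d∣n+m)

prime∣m∧∣2+m⇒≡2 : Prime p → p ∣ m → p ∣ 2 + m → p ≡ 2
prime∣m∧∣2+m⇒≡2 p-prime p∣m p∣2+m with prime⇒irreducible prime[2] (∣n+m∣m⇒∣n 2 p∣2+m p∣m)
... | inj₁ refl = contradiction p-prime ¬prime[1]
... | inj₂ p≡2  = p≡2

3∣a∧ab≡3p^x⇒p∣a∧p∣b : Prime p → 3 < a → 1 < b → a * b ≡ 3 * p ^ x → 3 ∣ a → p ∣ a × p ∣ b
3∣a∧ab≡3p^x⇒p∣a∧p∣b {p} {b = b} {x} p-prime 3<a 1<b ab≡3p^x (divides-refl c) =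
  ∣-trans (∣p^x⇒p∣ {x = x} p-prime 1<c (subst (c ∣_) cb≡p^x (m∣m*n b))) (m∣m*n 3) ,
  ∣p^x⇒p∣ {x = x} p-prime 1<b (subst (b ∣_) cb≡p^x (n∣m*n c))
  where
  1<c : 1 < c
  1<c = *-cancelʳ-< 3 1 c 3<a

  cb≡p^x : c * b ≡ p ^ x
  cb≡p^x = *-cancelˡ-≡ (c * b) (p ^ x) 3 (begin
    3 * (c * b) ≡⟨ solve (c ∷ b ∷ []) ⟩
    c * 3 * b   ≡⟨ ab≡3p^x ⟩
    3 * p ^ x   ∎)
    where open ≡-Reasoning

ab≡3p^x⇒p∣a∧p∣b : Prime p → 3 < a → 3 < b → a * b ≡ 3 * p ^ x → p ∣ a × p ∣ b
ab≡3p^x⇒p∣a∧p∣b {p} {a} {b} {x} p-prime 3<a 3<b ab≡3p^x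
  with euclidsLemma a b prime[3] (subst (3 ∣_) (sym ab≡3p^x) (m∣m*n (p ^ x)))
... | inj₁ 3∣a = 3∣a∧ab≡3p^x⇒p∣a∧p∣b {x = x} p-prime 3<a (<-trans 1<3 3<b) ab≡3p^x 3∣a
... | inj₂ 3∣b = swap (3∣a∧ab≡3p^x⇒p∣a∧p∣b {x = x} p-prime 3<b (<-trans 1<3 3<a) (trans (*-comm b a) ab≡3p^x) 3∣b)

3∤n²+1 : ∀ n → 3 ∤ n * n + 1
3∤n²+1 0 = from-no (3 ∣? 1)
3∤n²+1 1 = from-no (3 ∣? 2)
3∤n²+1 2 = from-no (3 ∣? 5)
3∤n²+1 (suc (suc (suc n))) 3∣[3+n]²+1 =
  3∤n²+1 n (∣m+n∣m⇒∣n (subst (3 ∣_) expand 3∣[3+n]²+1) (n∣m*n (2 * n + 3)))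
  where
  expand : (3 + n) * (3 + n) + 1 ≡ (2 * n + 3) * 3 + (n * n + 1)
  expand = solve (n ∷ [])

3∤4n²+1 : ∀ n → 3 ∤ 4 * (n * n) + 1
3∤4n²+1 n 3∣4n²+1 =
  3∤n²+1 n (∣m+n∣m⇒∣n (subst (3 ∣_) split 3∣4n²+1) (n∣m*n (n * n)))
  where
  split : 4 * (n * n) + 1 ≡ n * n * 3 + (n * n + 1)
  split = solve (n ∷ [])

4[3+k]²≢3p^x+1 : Prime p → p ≢ 2 → ∀ k → 4 * ((3 + k) * (3 + k)) ≢ 3 * p ^ x + 1
4[3+k]²≢3p^x+1 {p} {x} p-prime p≢2 k eq with ab≡3p^x⇒p∣a∧p∣b {x = x} p-prime 3<5+2k 3<7+2k factored
  where
  3<5+2k : 3 < 5 + 2 * k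
  3<5+2k = s≤s (s≤s (s≤s (s≤s z≤n)))

  3<7+2k : 3 < 7 + 2 * k
  3<7+2k = s≤s (s≤s (s≤s (s≤s z≤n)))

  factored : (5 + 2 * k) * (7 + 2 * k) ≡ 3 * p ^ x
  factored = suc-injective (begin
    1 + (5 + 2 * k) * (7 + 2 * k) ≡⟨ solve (k ∷ []) ⟩
    4 * ((3 + k) * (3 + k))       ≡⟨ eq ⟩
    3 * p ^ x + 1                 ≡⟨ +-comm (3 * p ^ x) 1 ⟩
    1 + 3 * p ^ x                 ∎)
    where open ≡-Reasoning
... | p∣5+2k , p∣7+2k = p≢2 (prime∣m∧∣2+m⇒≡2 p-prime p∣5+2k p∣7+2k)

lemma4p6 : (p q₅ : ℕ) → Prime p → Prime q₅ → p ≢ 2 → q₅ ≢ 2 → p ≢ q₅ →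
    (x : ℕ) → NonZero x →
    ¬ ((4 * (q₅ * q₅) ≡ 3 * p ^ x + 1) ⊎ (4 * (q₅ * q₅) + 1 ≡ 3 * p ^ x))
lemma4p6 p q₅ _ _ _ _ _ x _ (inj₂ eq) = 3∤4n²+1 q₅ (subst (3 ∣_) (sym eq) (m∣m*n (p ^ x)))
lemma4p6 _ 0 _ q-prime _ _ _ _ _ (inj₁ _) = ¬prime[0] q-prime
lemma4p6 _ 1 _ q-prime _ _ _ _ _ (inj₁ _) = ¬prime[1] q-prime
lemma4p6 _ 2 _ _ _ q≢2 _ _ _ (inj₁ _) = q≢2 refl
lemma4p6 _ (suc (suc (suc k))) p-prime _ p≢2 _ _ x _ (inj₁ eq) = 4[3+k]²≢3p^x+1 {x = x} p-prime p≢2 k eq
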